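{- Let $\mathcal{C}$ be a compact closed category. Then $\mathcal{C}_{\mathcal{P}_\omega}$ (defined below) is a compact closed category, whose monoidal product agrees with that of $\mathcal{C}$ on objects and on morphisms is given by $U\otimes U'=\{u\otimes u'\mid u\in U,u'\in U'\}$, and there is a strict monoidal embedding $\mathcal{C}\to\mathcal{C}_{\mathcal{P}_\omega}$ that is the identity on objects (sending $f\mapsto\{f\}$). Moreover, if $\mathcal{C}$ is dagger compact closed, then $\mathcal{C}_{\mathcal{P}_\omega}$ is dagger compact closed with dagger $U^{\dagger}=\{u^\dagger\mid u\in U\}$.
   Context: For a category $\mathcal{C}$, $\mathcal{C}_{\mathcal{P}_\omega}$ has the same objects as $\mathcal{C}$, hom-sets $\mathcal{C}_{\mathcal{P}_\omega}(A,B)$ = the set of all finite subsets (including $\emptyset$) of $\mathcal{C}(A,B)$, composition $V\circ U=\{v\circ u\mid v\in V,u\in U\}$, and identities $\{1_A\}$. Structural isomorphisms and cups/caps are the singletons of those of $\mathcal{C}$. -}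

module Defs where

open import Level using (Level; _⊔_) renaming (suc to lsuc)
open import Relation.Binary.Core using (Rel)
open import Relation.Binary.Structures using (IsEquivalence)
open import Data.Product.Base using (_×_)
open import Data.List.Base using (List; [_]; map; cartesianProductWith)
open import Data.List.Relation.Unary.Any using (Any)

record ObjStructure {o} (Obj : Set o) : Set o where
  infixr 10 _⊗₀_
  infix 11 _*
  field
    _⊗₀_ : Obj → Obj → Obj
    unit : Obj
    _*   : Obj → Obj

record CCStructure {o} {Obj : Set o} (O : ObjStructure Obj) (ℓ e : Level)
       : Set (o ⊔ lsuc (ℓ ⊔ e)) where
  open ObjStructure O
  infix 4 _≈_
  infixr 9 _∘_
  infixr 10 _⊗₁_
  field
    Hom  : Obj → Obj → Set ℓ
    _≈_  : ∀ {A B} → Rel (Hom A B) e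
    id   : ∀ {A} → Hom A A
    _∘_  : ∀ {A B C} → Hom B C → Hom A B → Hom A C
    _⊗₁_ : ∀ {A B C D} → Hom A B → Hom C D → Hom (A ⊗₀ C) (B ⊗₀ D)
    α    : ∀ {A B C} → Hom ((A ⊗₀ B) ⊗₀ C) (A ⊗₀ (B ⊗₀ C))
    α⁻¹  : ∀ {A B C} → Hom (A ⊗₀ (B ⊗₀ C)) ((A ⊗₀ B) ⊗₀ C)
    λ⇒   : ∀ {A} → Hom (unit ⊗₀ A) A
    λ⇐   : ∀ {A} → Hom A (unit ⊗₀ A)
    ρ⇒   : ∀ {A} → Hom (A ⊗₀ unit) A
    ρ⇐   : ∀ {A} → Hom A (A ⊗₀ unit)
    σ    : ∀ {A B} → Hom (A ⊗₀ B) (B ⊗₀ A)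
    η    : ∀ {A} → Hom unit (A * ⊗₀ A)
    ε    : ∀ {A} → Hom (A ⊗₀ A *) unit

record IsCompactClosed {o ℓ e} {Obj : Set o} {O : ObjStructure Obj}
       (𝒞 : CCStructure O ℓ e) : Set (o ⊔ ℓ ⊔ e) where
  open ObjStructure O
  open CCStructure 𝒞
  field
    equiv      : ∀ {A B} → IsEquivalence (_≈_ {A} {B})
    ∘-resp-≈   : ∀ {A B C} {f h : Hom B C} {g i : Hom A B} →
                 f ≈ h → g ≈ i → f ∘ g ≈ h ∘ i
    assoc      : ∀ {A B C D} {f : Hom A B} {g : Hom B C} {h : Hom C D} →
                 (h ∘ g) ∘ f ≈ h ∘ (g ∘ f)
    identityˡ  : ∀ {A B} {f : Hom A B} → id ∘ f ≈ f
    identityʳ  : ∀ {A B} {f : Hom A B} → f ∘ id ≈ f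
    ⊗-resp-≈   : ∀ {A B C D} {f f′ : Hom A B} {g g′ : Hom C D} →
                 f ≈ f′ → g ≈ g′ → f ⊗₁ g ≈ f′ ⊗₁ g′
    ⊗-identity : ∀ {A B} → id {A} ⊗₁ id {B} ≈ id
    ⊗-homomorphism : ∀ {A B C D E F} {f : Hom A B} {g : Hom B C}
                       {h : Hom D E} {k : Hom E F} →
                     (g ∘ f) ⊗₁ (k ∘ h) ≈ (g ⊗₁ k) ∘ (f ⊗₁ h)
    α-isoˡ     : ∀ {A B C} → α⁻¹ ∘ α ≈ id {(A ⊗₀ B) ⊗₀ C}
    α-isoʳ     : ∀ {A B C} → α ∘ α⁻¹ ≈ id {A ⊗₀ (B ⊗₀ C)}
    λ-isoˡ     : ∀ {A} → λ⇐ ∘ λ⇒ ≈ id {unit ⊗₀ A}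
    λ-isoʳ     : ∀ {A} → λ⇒ ∘ λ⇐ ≈ id {A}
    ρ-isoˡ     : ∀ {A} → ρ⇐ ∘ ρ⇒ ≈ id {A ⊗₀ unit}
    ρ-isoʳ     : ∀ {A} → ρ⇒ ∘ ρ⇐ ≈ id {A}
    α-natural  : ∀ {A B C D E F} {f : Hom A B} {g : Hom C D} {h : Hom E F} →
                 α ∘ ((f ⊗₁ g) ⊗₁ h) ≈ (f ⊗₁ (g ⊗₁ h)) ∘ α
    λ-natural  : ∀ {A B} {f : Hom A B} → λ⇒ ∘ (id {unit} ⊗₁ f) ≈ f ∘ λ⇒
    ρ-natural  : ∀ {A B} {f : Hom A B} → ρ⇒ ∘ (f ⊗₁ id {unit}) ≈ f ∘ ρ⇒
    pentagon   : ∀ {A B C D} →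
                 (id {A} ⊗₁ α {B} {C} {D}) ∘ α {A} {B ⊗₀ C} {D} ∘ (α {A} {B} {C} ⊗₁ id {D})
                 ≈ α {A} {B} {C ⊗₀ D} ∘ α {A ⊗₀ B} {C} {D}
    triangle   : ∀ {A B} →
                 (id {A} ⊗₁ λ⇒ {B}) ∘ α {A} {unit} {B} ≈ ρ⇒ {A} ⊗₁ id {B}
    σ-natural  : ∀ {A B C D} {f : Hom A B} {g : Hom C D} →
                 σ ∘ (f ⊗₁ g) ≈ (g ⊗₁ f) ∘ σ
    σ-involutive : ∀ {A B} → σ {B} {A} ∘ σ {A} {B} ≈ id
    hexagon    : ∀ {A B C} →
                 α {B} {C} {A} ∘ σ {A} {B ⊗₀ C} ∘ α {A} {B} {C}
                 ≈ (id {B} ⊗₁ σ {A} {C}) ∘ α {B} {A} {C} ∘ (σ {A} {B} ⊗₁ id {C})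
    snake₁     : ∀ {A} →
                 λ⇒ ∘ (ε {A} ⊗₁ id {A}) ∘ α⁻¹ ∘ (id {A} ⊗₁ η {A}) ∘ ρ⇐ ≈ id {A}
    snake₂     : ∀ {A} →
                 ρ⇒ ∘ (id {A *} ⊗₁ ε {A}) ∘ α ∘ (η {A} ⊗₁ id {A *}) ∘ λ⇐ ≈ id {A *}

DaggerOp : ∀ {o ℓ e} {Obj : Set o} {O : ObjStructure Obj} →
           CCStructure O ℓ e → Set (o ⊔ ℓ)
DaggerOp 𝒞 = ∀ {A B} → Hom A B → Hom B A
  where open CCStructure 𝒞

record IsDaggerCompact {o ℓ e} {Obj : Set o} {O : ObjStructure Obj}
       (𝒞 : CCStructure O ℓ e) (_† : DaggerOp 𝒞) : Set (o ⊔ ℓ ⊔ e) where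
  open ObjStructure O
  open CCStructure 𝒞
  field
    isCompactClosed : IsCompactClosed 𝒞
    †-resp-≈       : ∀ {A B} {f g : Hom A B} → f ≈ g → f † ≈ g †
    †-involutive   : ∀ {A B} {f : Hom A B} → (f †) † ≈ f
    †-identity     : ∀ {A} → (id {A}) † ≈ id
    †-homomorphism : ∀ {A B C} {f : Hom A B} {g : Hom B C} → (g ∘ f) † ≈ f † ∘ g †
    †-⊗            : ∀ {A B C D} {f : Hom A B} {g : Hom C D} → (f ⊗₁ g) † ≈ f † ⊗₁ g †
    α-unitary      : ∀ {A B C} → (α {A} {B} {C}) † ≈ α⁻¹
    λ-unitary      : ∀ {A} → (λ⇒ {A}) † ≈ λ⇐
    ρ-unitary      : ∀ {A} → (ρ⇒ {A}) † ≈ ρ⇐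
    σ-unitary      : ∀ {A B} → (σ {A} {B}) † ≈ σ {B} {A}
    ε-η            : ∀ {A} → ε {A} ≈ (η {A}) † ∘ σ {A} {A *}

-- Strict monoidal embedding that is the identity on objects
-- (both categories share the same objects and ⊗ on objects).

record IsStrictMonoidalEmbedding {o ℓ e ℓ′ e′} {Obj : Set o} {O : ObjStructure Obj}
       (𝒞 : CCStructure O ℓ e) (𝒟 : CCStructure O ℓ′ e′)
       (F : ∀ {A B} → CCStructure.Hom 𝒞 A B → CCStructure.Hom 𝒟 A B)
       : Set (o ⊔ ℓ ⊔ e ⊔ e′) where
  open ObjStructure O
  module C = CCStructure 𝒞
  module D = CCStructure 𝒟
  field
    F-resp-≈       : ∀ {A B} {f g : C.Hom A B} → f C.≈ g → F f D.≈ F g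
    faithful       : ∀ {A B} {f g : C.Hom A B} → F f D.≈ F g → f C.≈ g
    F-identity     : ∀ {A} → F (C.id {A}) D.≈ D.id
    F-homomorphism : ∀ {A B C} {f : C.Hom A B} {g : C.Hom B C} →
                     F (g C.∘ f) D.≈ F g D.∘ F f
    F-⊗            : ∀ {A B C D} {f : C.Hom A B} {g : C.Hom C D} →
                     F (f C.⊗₁ g) D.≈ F f D.⊗₁ F g
    F-α            : ∀ {A B C} → F (C.α {A} {B} {C}) D.≈ D.α
    F-λ            : ∀ {A} → F (C.λ⇒ {A}) D.≈ D.λ⇒
    F-ρ            : ∀ {A} → F (C.ρ⇒ {A}) D.≈ D.ρ⇒

-- The construction 𝒞_{P_ω}: hom-sets are finite subsets of 𝒞(A,B),
-- represented as lists up to extensional set equality (membership taken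
-- w.r.t. the hom-setoid of 𝒞).

module _ {o ℓ e} {Obj : Set o} {O : ObjStructure Obj} (𝒞 : CCStructure O ℓ e) where
  open CCStructure 𝒞

  infix 4 _∈ₛ_ _⊆ₛ_ _≐_

  _∈ₛ_ : ∀ {A B} → Hom A B → List (Hom A B) → Set (ℓ ⊔ e)
  f ∈ₛ U = Any (f ≈_) U

  _⊆ₛ_ : ∀ {A B} → List (Hom A B) → List (Hom A B) → Set (ℓ ⊔ e)
  U ⊆ₛ V = ∀ {f} → f ∈ₛ U → f ∈ₛ V

  _≐_ : ∀ {A B} → List (Hom A B) → List (Hom A B) → Set (ℓ ⊔ e)
  U ≐ V = U ⊆ₛ V × V ⊆ₛ U

  Pω : CCStructure O ℓ (ℓ ⊔ e)
  Pω = record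
    { Hom  = λ A B → List (Hom A B)
    ; _≈_  = _≐_
    ; id   = [ id ]
    ; _∘_  = λ V U → cartesianProductWith _∘_ V U
    ; _⊗₁_ = λ U U′ → cartesianProductWith _⊗₁_ U U′
    ; α    = [ α ]
    ; α⁻¹  = [ α⁻¹ ]
    ; λ⇒   = [ λ⇒ ]
    ; λ⇐   = [ λ⇐ ]
    ; ρ⇒   = [ ρ⇒ ]
    ; ρ⇐   = [ ρ⇐ ]
    ; σ    = [ σ ]
    ; η    = [ η ]
    ; ε    = [ ε ]
    }

  singleton : ∀ {A B} → Hom A B → CCStructure.Hom Pω A B
  singleton f = [ f ]

  Pω-dagger : DaggerOp 𝒞 → DaggerOp Pω
  Pω-dagger _† U = map _† U

module Submission where

-- Laws between singletons (pentagon, snakes, unitarity, …) hold since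
-- singletons compose and tensor to singletons by computation, so {f} ≐ {g}
-- follows from f ≈ g.  Laws involving arbitrary subsets (associativity,
-- units, functoriality of ⊗, naturality, dagger laws) equate two elementwise
-- images: a member of one side is taken apart into its constituents and
-- reassembled on the other side by the same law of 𝒞.

open import Defs
open import Data.Product.Base using (_×_; _,_)
open import Data.List.Base using (List; [_]; map; cartesianProductWith)
open import Data.List.Relation.Unary.Any as Any using (here)
open import Data.List.Membership.Propositional using (_∈_; find; lose)
open import Data.List.Membership.Propositional.Properties
  using (∈-cartesianProductWith⁺; ∈-cartesianProductWith⁻; ∈-map⁺; ∈-map⁻)
open import Relation.Binary.PropositionalEquality using (refl)
open import Relation.Binary.Structures using (IsEquivalence)

module FiniteSubsets {o ℓ e} {Obj : Set o} {O : ObjStructure Obj}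
         (𝒞 : CCStructure O ℓ e)
         (≈-equiv : ∀ {A B} → IsEquivalence (CCStructure._≈_ 𝒞 {A} {B})) where
  open CCStructure 𝒞
  module ≈ {A B : Obj} = IsEquivalence (≈-equiv {A} {B})

  private
    variable
      A B C D E F : Obj
      x y : Hom A B
      U V W : List (Hom A B)

  ∈ₛ-resp-≈ : x ≈ y → _∈ₛ_ 𝒞 y W → _∈ₛ_ 𝒞 x W
  ∈ₛ-resp-≈ x≈y = Any.map (≈.trans x≈y)

  ∈ₛ-intro : x ≈ y → y ∈ U → _∈ₛ_ 𝒞 x U
  ∈ₛ-intro x≈y y∈U = lose y∈U x≈y

  ⊆ₛ-intro : (∀ {y} → y ∈ U → _∈ₛ_ 𝒞 y V) → _⊆ₛ_ 𝒞 U V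
  ⊆ₛ-intro sub x∈U = let _ , y∈U , x≈y = find x∈U in ∈ₛ-resp-≈ x≈y (sub y∈U)

  ≐-isEquivalence : IsEquivalence (_≐_ 𝒞 {A} {B})
  ≐-isEquivalence = record
    { refl  = (λ m → m) , (λ m → m)
    ; sym   = λ (U⊆V , V⊆U) → V⊆U , U⊆V
    ; trans = λ (U⊆V , V⊆U) (V⊆W , W⊆V) → (λ m → V⊆W (U⊆V m)) , (λ m → V⊆U (W⊆V m))
    }

  ∈-singleton : x ∈ [ x ]
  ∈-singleton = here refl

  singleton-cong : x ≈ y → _≐_ 𝒞 [ x ] [ y ]
  singleton-cong x≈y = ⊆ₛ-intro (λ { (here refl) → here x≈y })
                     , ⊆ₛ-intro (λ { (here refl) → here (≈.sym x≈y) })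

  singleton-injective : _≐_ 𝒞 [ x ] [ y ] → x ≈ y
  singleton-injective ([x]⊆[y] , _) with [x]⊆[y] (here ≈.refl)
  ... | here x≈y = x≈y

  product-elim : ∀ {p} (op : Hom A B → Hom C D → Hom E F)
                 (U : List (Hom A B)) (V : List (Hom C D)) {P : Hom E F → Set p} →
                 (∀ {u v} → u ∈ U → v ∈ V → P (op u v)) →
                 ∀ {y} → y ∈ cartesianProductWith op U V → P y
  product-elim op U V h y∈ with ∈-cartesianProductWith⁻ op U V y∈
  ... | _ , _ , u∈ , v∈ , refl = h u∈ v∈

  product-⊆ : ∀ (op : Hom A B → Hom C D → Hom E F)
              (U : List (Hom A B)) (V : List (Hom C D)) →
              (∀ {u v} → u ∈ U → v ∈ V → _∈ₛ_ 𝒞 (op u v) W) →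
              _⊆ₛ_ 𝒞 (cartesianProductWith op U V) W
  product-⊆ op U V h = ⊆ₛ-intro (product-elim op U V h)

  product-intro : ∀ (op : Hom A B → Hom C D → Hom E F) {u v} →
                  x ≈ op u v → u ∈ U → v ∈ V →
                  _∈ₛ_ 𝒞 x (cartesianProductWith op U V)
  product-intro op x≈ u∈ v∈ = ∈ₛ-intro x≈ (∈-cartesianProductWith⁺ op u∈ v∈)

  product-mono : ∀ (op : Hom A B → Hom C D → Hom E F) →
                 (∀ {u u′ v v′} → u ≈ u′ → v ≈ v′ → op u v ≈ op u′ v′) →
                 ∀ {U U′ : List (Hom A B)} {V V′ : List (Hom C D)} →
                 _⊆ₛ_ 𝒞 U U′ → _⊆ₛ_ 𝒞 V V′ →
                 _⊆ₛ_ 𝒞 (cartesianProductWith op U V) (cartesianProductWith op U′ V′)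
  product-mono op op-resp U⊆U′ V⊆V′ = product-⊆ op _ _ λ u∈ v∈ →
    let _ , u′∈ , u≈u′ = find (U⊆U′ (∈ₛ-intro ≈.refl u∈))
        _ , v′∈ , v≈v′ = find (V⊆V′ (∈ₛ-intro ≈.refl v∈))
    in product-intro op (op-resp u≈u′ v≈v′) u′∈ v′∈

  product-cong : ∀ (op : Hom A B → Hom C D → Hom E F) →
                 (∀ {u u′ v v′} → u ≈ u′ → v ≈ v′ → op u v ≈ op u′ v′) →
                 ∀ {U U′ : List (Hom A B)} {V V′ : List (Hom C D)} →
                 _≐_ 𝒞 U U′ → _≐_ 𝒞 V V′ →
                 _≐_ 𝒞 (cartesianProductWith op U V) (cartesianProductWith op U′ V′)
  product-cong op op-resp (U⊆U′ , U′⊆U) (V⊆V′ , V′⊆V) =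
    product-mono op op-resp U⊆U′ V⊆V′ , product-mono op op-resp U′⊆U V′⊆V

  map-elim : ∀ {p} (f : Hom A B → Hom C D) (U : List (Hom A B))
             {P : Hom C D → Set p} →
             (∀ {u} → u ∈ U → P (f u)) → ∀ {y} → y ∈ map f U → P y
  map-elim f U h y∈ with ∈-map⁻ f y∈
  ... | _ , u∈ , refl = h u∈

  map-⊆ : ∀ (f : Hom A B → Hom C D) (U : List (Hom A B)) →
          (∀ {u} → u ∈ U → _∈ₛ_ 𝒞 (f u) W) → _⊆ₛ_ 𝒞 (map f U) W
  map-⊆ f U h = ⊆ₛ-intro (map-elim f U h)

  map-intro : ∀ (f : Hom A B → Hom C D) {u} → x ≈ f u → u ∈ U →
              _∈ₛ_ 𝒞 x (map f U)
  map-intro f x≈ u∈ = ∈ₛ-intro x≈ (∈-map⁺ f u∈)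

  map-mono : ∀ (f : Hom A B → Hom C D) → (∀ {u u′} → u ≈ u′ → f u ≈ f u′) →
             ∀ {U U′ : List (Hom A B)} → _⊆ₛ_ 𝒞 U U′ → _⊆ₛ_ 𝒞 (map f U) (map f U′)
  map-mono f f-resp U⊆U′ = map-⊆ f _ λ u∈ →
    let _ , u′∈ , u≈u′ = find (U⊆U′ (∈ₛ-intro ≈.refl u∈))
    in map-intro f (f-resp u≈u′) u′∈

module PωLaws {o ℓ e} {Obj : Set o} {O : ObjStructure Obj}
         (𝒞 : CCStructure O ℓ e) (cc : IsCompactClosed 𝒞) where
  open CCStructure 𝒞
  open IsCompactClosed cc
  open FiniteSubsets 𝒞 equiv public
  open CCStructure (Pω 𝒞) using ()
    renaming (Hom to Homₚ; _∘_ to _∘ₚ_; _⊗₁_ to _⊗ₚ_; _≈_ to _≐ₚ_)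

  private
    variable
      A B C D E F : Obj

  Pω-assoc : (f : Homₚ A B) (g : Homₚ B C) (h : Homₚ C D) →
             (h ∘ₚ g) ∘ₚ f ≐ₚ h ∘ₚ (g ∘ₚ f)
  Pω-assoc f g h =
      product-⊆ _∘_ (h ∘ₚ g) f (λ hg∈ c∈ → product-elim _∘_ h g (λ a∈ b∈ →
        product-intro _∘_ assoc a∈ (∈-cartesianProductWith⁺ _∘_ b∈ c∈)) hg∈)
    , product-⊆ _∘_ h (g ∘ₚ f) (λ a∈ gf∈ → product-elim _∘_ g f (λ b∈ c∈ →
        product-intro _∘_ (≈.sym assoc) (∈-cartesianProductWith⁺ _∘_ a∈ b∈) c∈) gf∈)

  Pω-identityˡ : (f : Homₚ A B) → [ id ] ∘ₚ f ≐ₚ f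
  Pω-identityˡ f =
      product-⊆ _∘_ [ id ] f (λ { (here refl) v∈ → ∈ₛ-intro identityˡ v∈ })
    , ⊆ₛ-intro (λ v∈ → product-intro _∘_ (≈.sym identityˡ) ∈-singleton v∈)

  Pω-identityʳ : (f : Homₚ A B) → f ∘ₚ [ id ] ≐ₚ f
  Pω-identityʳ f =
      product-⊆ _∘_ f [ id ] (λ { u∈ (here refl) → ∈ₛ-intro identityʳ u∈ })
    , ⊆ₛ-intro (λ u∈ → product-intro _∘_ (≈.sym identityʳ) u∈ ∈-singleton)

  Pω-⊗-homomorphism : (f : Homₚ A B) (g : Homₚ B C) (h : Homₚ D E) (k : Homₚ E F) →
                      (g ∘ₚ f) ⊗ₚ (k ∘ₚ h) ≐ₚ (g ⊗ₚ k) ∘ₚ (f ⊗ₚ h)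
  Pω-⊗-homomorphism f g h k =
      product-⊆ _⊗₁_ (g ∘ₚ f) (k ∘ₚ h) (λ gf∈ kh∈ →
        product-elim _∘_ g f (λ b∈ a∈ → product-elim _∘_ k h (λ d∈ c∈ →
          product-intro _∘_ ⊗-homomorphism
            (∈-cartesianProductWith⁺ _⊗₁_ b∈ d∈) (∈-cartesianProductWith⁺ _⊗₁_ a∈ c∈))
          kh∈) gf∈)
    , product-⊆ _∘_ (g ⊗ₚ k) (f ⊗ₚ h) (λ gk∈ fh∈ →
        product-elim _⊗₁_ g k (λ b∈ d∈ → product-elim _⊗₁_ f h (λ a∈ c∈ →
          product-intro _⊗₁_ (≈.sym ⊗-homomorphism)
            (∈-cartesianProductWith⁺ _∘_ b∈ a∈) (∈-cartesianProductWith⁺ _∘_ d∈ c∈))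
          fh∈) gk∈)

  Pω-α-natural : (f : Homₚ A B) (g : Homₚ C D) (h : Homₚ E F) →
                 [ α ] ∘ₚ ((f ⊗ₚ g) ⊗ₚ h) ≐ₚ (f ⊗ₚ (g ⊗ₚ h)) ∘ₚ [ α ]
  Pω-α-natural f g h =
      product-⊆ _∘_ [ α ] ((f ⊗ₚ g) ⊗ₚ h) (λ { (here refl) fgh∈ →
        product-elim _⊗₁_ (f ⊗ₚ g) h (λ fg∈ c∈ → product-elim _⊗₁_ f g (λ a∈ b∈ →
          product-intro _∘_ α-natural
            (∈-cartesianProductWith⁺ _⊗₁_ a∈ (∈-cartesianProductWith⁺ _⊗₁_ b∈ c∈))
            ∈-singleton) fg∈) fgh∈ })
    , product-⊆ _∘_ (f ⊗ₚ (g ⊗ₚ h)) [ α ] (λ { fgh∈ (here refl) →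
        product-elim _⊗₁_ f (g ⊗ₚ h) (λ a∈ gh∈ → product-elim _⊗₁_ g h (λ b∈ c∈ →
          product-intro _∘_ (≈.sym α-natural) ∈-singleton
            (∈-cartesianProductWith⁺ _⊗₁_ (∈-cartesianProductWith⁺ _⊗₁_ a∈ b∈) c∈))
          gh∈) fgh∈ })

  Pω-λ-natural : (f : Homₚ A B) → [ λ⇒ ] ∘ₚ ([ id ] ⊗ₚ f) ≐ₚ f ∘ₚ [ λ⇒ ]
  Pω-λ-natural f =
      product-⊆ _∘_ [ λ⇒ ] ([ id ] ⊗ₚ f) (λ { (here refl) idf∈ →
        product-elim _⊗₁_ [ id ] f (λ { (here refl) a∈ →
          product-intro _∘_ λ-natural a∈ ∈-singleton }) idf∈ })
    , product-⊆ _∘_ f [ λ⇒ ] (λ { a∈ (here refl) →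
        product-intro _∘_ (≈.sym λ-natural) ∈-singleton
          (∈-cartesianProductWith⁺ _⊗₁_ ∈-singleton a∈) })

  Pω-ρ-natural : (f : Homₚ A B) → [ ρ⇒ ] ∘ₚ (f ⊗ₚ [ id ]) ≐ₚ f ∘ₚ [ ρ⇒ ]
  Pω-ρ-natural f =
      product-⊆ _∘_ [ ρ⇒ ] (f ⊗ₚ [ id ]) (λ { (here refl) fid∈ →
        product-elim _⊗₁_ f [ id ] (λ { a∈ (here refl) →
          product-intro _∘_ ρ-natural a∈ ∈-singleton }) fid∈ })
    , product-⊆ _∘_ f [ ρ⇒ ] (λ { a∈ (here refl) →
        product-intro _∘_ (≈.sym ρ-natural) ∈-singleton
          (∈-cartesianProductWith⁺ _⊗₁_ a∈ ∈-singleton) })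

  Pω-σ-natural : (f : Homₚ A B) (g : Homₚ C D) →
                 [ σ ] ∘ₚ (f ⊗ₚ g) ≐ₚ (g ⊗ₚ f) ∘ₚ [ σ ]
  Pω-σ-natural f g =
      product-⊆ _∘_ [ σ ] (f ⊗ₚ g) (λ { (here refl) fg∈ →
        product-elim _⊗₁_ f g (λ a∈ b∈ →
          product-intro _∘_ σ-natural (∈-cartesianProductWith⁺ _⊗₁_ b∈ a∈) ∈-singleton)
          fg∈ })
    , product-⊆ _∘_ (g ⊗ₚ f) [ σ ] (λ { gf∈ (here refl) →
        product-elim _⊗₁_ g f (λ b∈ a∈ →
          product-intro _∘_ (≈.sym σ-natural) ∈-singleton (∈-cartesianProductWith⁺ _⊗₁_ a∈ b∈))
          gf∈ })

  Pω-isCompactClosed : IsCompactClosed (Pω 𝒞)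
  Pω-isCompactClosed = record
    { equiv          = ≐-isEquivalence
    ; ∘-resp-≈       = product-cong _∘_ ∘-resp-≈
    ; assoc          = λ {f = f} {g} {h} → Pω-assoc f g h
    ; identityˡ      = λ {f = f} → Pω-identityˡ f
    ; identityʳ      = λ {f = f} → Pω-identityʳ f
    ; ⊗-resp-≈       = product-cong _⊗₁_ ⊗-resp-≈
    ; ⊗-identity     = singleton-cong ⊗-identity
    ; ⊗-homomorphism = λ {f = f} {g} {h} {k} → Pω-⊗-homomorphism f g h k
    ; α-isoˡ         = singleton-cong α-isoˡ
    ; α-isoʳ         = singleton-cong α-isoʳ
    ; λ-isoˡ         = singleton-cong λ-isoˡ
    ; λ-isoʳ         = singleton-cong λ-isoʳ
    ; ρ-isoˡ         = singleton-cong ρ-isoˡ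
    ; ρ-isoʳ         = singleton-cong ρ-isoʳ
    ; α-natural      = λ {f = f} {g} {h} → Pω-α-natural f g h
    ; λ-natural      = λ {f = f} → Pω-λ-natural f
    ; ρ-natural      = λ {f = f} → Pω-ρ-natural f
    ; pentagon       = singleton-cong pentagon
    ; triangle       = singleton-cong triangle
    ; σ-natural      = λ {f = f} {g} → Pω-σ-natural f g
    ; σ-involutive   = singleton-cong σ-involutive
    ; hexagon        = singleton-cong hexagon
    ; snake₁         = singleton-cong snake₁
    ; snake₂         = singleton-cong snake₂
    }

  -- f ↦ {f} preserves composition, ⊗ and the structural isomorphisms on the
  -- nose (singletons compose to singletons by computation), and it is
  -- faithful because {f} ≐ {g} forces f ≈ g.
  singleton-isStrictMonoidalEmbedding :
    IsStrictMonoidalEmbedding 𝒞 (Pω 𝒞) (singleton 𝒞)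
  singleton-isStrictMonoidalEmbedding = record
    { F-resp-≈       = singleton-cong
    ; faithful       = singleton-injective
    ; F-identity     = singleton-cong ≈.refl
    ; F-homomorphism = singleton-cong ≈.refl
    ; F-⊗            = singleton-cong ≈.refl
    ; F-α            = singleton-cong ≈.refl
    ; F-λ            = singleton-cong ≈.refl
    ; F-ρ            = singleton-cong ≈.refl
    }

module PωDaggerLaws {o ℓ e} {Obj : Set o} {O : ObjStructure Obj}
         (𝒞 : CCStructure O ℓ e) (_† : DaggerOp 𝒞) (dc : IsDaggerCompact 𝒞 _†) where
  open CCStructure 𝒞
  open IsDaggerCompact dc
  open PωLaws 𝒞 isCompactClosed
  open CCStructure (Pω 𝒞) using ()
    renaming (Hom to Homₚ; _∘_ to _∘ₚ_; _⊗₁_ to _⊗ₚ_; _≈_ to _≐ₚ_)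

  private
    variable
      A B C D : Obj
    _†ₚ : Homₚ A B → Homₚ B A
    U †ₚ = Pω-dagger 𝒞 _† U

  Pω-†-involutive : (f : Homₚ A B) → (f †ₚ) †ₚ ≐ₚ f
  Pω-†-involutive f =
      map-⊆ _† (f †ₚ) (λ u∈ → map-elim _† f (λ a∈ → ∈ₛ-intro †-involutive a∈) u∈)
    , ⊆ₛ-intro (λ a∈ → map-intro _† (≈.sym †-involutive) (∈-map⁺ _† a∈))

  Pω-†-homomorphism : (f : Homₚ A B) (g : Homₚ B C) → (g ∘ₚ f) †ₚ ≐ₚ f †ₚ ∘ₚ g †ₚ
  Pω-†-homomorphism f g =
      map-⊆ _† (g ∘ₚ f) (product-elim _∘_ g f λ b∈ a∈ →
        product-intro _∘_ †-homomorphism (∈-map⁺ _† a∈) (∈-map⁺ _† b∈))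
    , product-⊆ _∘_ (f †ₚ) (g †ₚ) (λ a†∈ b†∈ →
        map-elim _† f (λ a∈ → map-elim _† g (λ b∈ →
          map-intro _† (≈.sym †-homomorphism) (∈-cartesianProductWith⁺ _∘_ b∈ a∈))
          b†∈) a†∈)

  Pω-†-⊗ : (f : Homₚ A B) (g : Homₚ C D) → (f ⊗ₚ g) †ₚ ≐ₚ f †ₚ ⊗ₚ g †ₚ
  Pω-†-⊗ f g =
      map-⊆ _† (f ⊗ₚ g) (product-elim _⊗₁_ f g λ a∈ b∈ →
        product-intro _⊗₁_ †-⊗ (∈-map⁺ _† a∈) (∈-map⁺ _† b∈))
    , product-⊆ _⊗₁_ (f †ₚ) (g †ₚ) (λ a†∈ b†∈ →
        map-elim _† f (λ a∈ → map-elim _† g (λ b∈ →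
          map-intro _† (≈.sym †-⊗) (∈-cartesianProductWith⁺ _⊗₁_ a∈ b∈))
          b†∈) a†∈)

  Pω-isDaggerCompact : IsDaggerCompact (Pω 𝒞) (Pω-dagger 𝒞 _†)
  Pω-isDaggerCompact = record
    { isCompactClosed = Pω-isCompactClosed
    ; †-resp-≈        = λ (U⊆V , V⊆U) → map-mono _† †-resp-≈ U⊆V , map-mono _† †-resp-≈ V⊆U
    ; †-involutive    = λ {f = f} → Pω-†-involutive f
    ; †-identity      = singleton-cong †-identity
    ; †-homomorphism  = λ {f = f} {g} → Pω-†-homomorphism f g
    ; †-⊗             = λ {f = f} {g} → Pω-†-⊗ f g
    ; α-unitary       = singleton-cong α-unitary
    ; λ-unitary       = singleton-cong λ-unitary
    ; ρ-unitary       = singleton-cong ρ-unitary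
    ; σ-unitary       = singleton-cong σ-unitary
    ; ε-η             = singleton-cong ε-η
    }

mainTheorem7 : ∀ {o ℓ e} {Obj : Set o} {O : ObjStructure Obj}
                 (𝒞 : CCStructure O ℓ e) →
                 IsCompactClosed 𝒞 →
                 IsCompactClosed (Pω 𝒞)
                 × IsStrictMonoidalEmbedding 𝒞 (Pω 𝒞) (singleton 𝒞)
                 × ((dag : DaggerOp 𝒞) → IsDaggerCompact 𝒞 dag →
                      IsDaggerCompact (Pω 𝒞) (Pω-dagger 𝒞 dag))
mainTheorem7 𝒞 cc =
    PωLaws.Pω-isCompactClosed 𝒞 cc
  , PωLaws.singleton-isStrictMonoidalEmbedding 𝒞 cc
  , λ dag dc → PωDaggerLaws.Pω-isDaggerCompact 𝒞 dag dc
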